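{- Let $p$ be an odd prime and $s\ge1$, $k\ge1$ integers. Then $$\rho_{k,0}(p^s)=\sum_{i=0}^{\lfloor (s-1)/2\rfloor}\Big(p^{ki}p^{(s-2i-1)(k-1)}\cdot\rho^{(1)}_{k,p^{s-2i}}(p)\Big)+p^{\lfloor s/2\rfloor k}.$$
   Context: For positive integers $k,n$ and an integer $\mu$, $\rho_{k,\mu}(n)$ is the number of $(x_1,\dots,x_k)\in(\mathbb{Z}/n\mathbb{Z})^k$ with $x_1^2+\cdots+x_k^2\equiv\mu\pmod n$. For a prime $p$, integers $t\ge1$ and $\mu$, $\rho^{(1)}_{k,\mu}(p^t)$ is the number of $(x_1,\dots,x_k)\in(\mathbb{Z}/p^t\mathbb{Z})^k$ with $x_1^2+\cdots+x_k^2\equiv\mu\pmod{p^t}$ and $p\nmid x_i$ for at least one $i$. -}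

module Defs where

open import Data.Nat using (ℕ; zero; suc; _+_; _*_; _^_)
open import Data.Nat.Divisibility using (_∣?_)
open import Data.Integer using (ℤ; +_; _-_; ∣_∣)
open import Data.Fin using (Fin; toℕ)
open import Data.List using (List; []; _∷_; [_]; map; concatMap; allFin; filter; length)
open import Data.Vec using (Vec; []; _∷_; foldr)
open import Data.Vec.Relation.Unary.Any using (any?)
open import Relation.Nullary using (¬?)
open import Relation.Nullary.Decidable using (_×-dec_)

tuples : (n k : ℕ) → List (Vec (Fin n) k)
tuples n zero    = [ [] ]
tuples n (suc k) = concatMap (λ x → map (x ∷_) (tuples n k)) (allFin n)

sumSq : ∀ {n k} → Vec (Fin n) k → ℕ
sumSq = foldr _ (λ x acc → toℕ x * toℕ x + acc) 0

-- ρ_{k,μ}(n) = #{x ∈ (ℤ/nℤ)^k : x₁²+⋯+xₖ² ≡ μ (mod n)}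
ρ : (k : ℕ) (μ : ℤ) (n : ℕ) → ℕ
ρ k μ n = length (filter (λ v → n ∣? ∣ + sumSq v - μ ∣) (tuples n k))

-- ρ^{(1)}_{k,μ}(p^t) = #{x ∈ (ℤ/p^tℤ)^k : x₁²+⋯+xₖ² ≡ μ (mod p^t), p ∤ xᵢ for some i}
ρ⁽¹⁾ : (k : ℕ) (μ : ℤ) (p t : ℕ) → ℕ
ρ⁽¹⁾ k μ p t =
  length (filter (λ v → ((p ^ t) ∣? ∣ + sumSq v - μ ∣) ×-dec any? (λ x → ¬? (p ∣? toℕ x)) v)
                 (tuples (p ^ t) k))

module Submission where

-- Let R t, P t and Q t count the solutions of x₁² + ⋯ + xₖ² ≡ 0 (mod pᵗ): all of them, the
-- primitive ones (p ∤ xᵢ for some i), and the rest. A non-primitive solution mod p^(t+2) is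
-- p z with z taken mod p^(t+1) and pᵗ ∣ ‖z‖², so Q (t + 2) = pᵏ R t, while Q 1 = 1. A primitive
-- solution y mod p^(t+1), say ‖y‖² = c p^(t+1), lifts to y + p^(t+1) z mod p^(t+2) exactly
-- when c + 2⟨y, z⟩ ≡ 0 (mod p); as p is odd this is a nondegenerate linear congruence in z,
-- with p^(k−1) solutions mod p. Hence P (t + 1) = p^(t(k−1)) P 1, and the recurrence
-- R (t + 2) = p^((t+1)(k−1)) P 1 + pᵏ R t with R 0 = 1, R 1 = P 1 + 1 unrolls to the formula.
-- Finally ρ⁽¹⁾_{k,pʲ}(p) = P 1 for j ≥ 1, since pʲ ≡ 0 (mod p).

open import Data.Bool using (true; false; if_then_else_)
open import Data.Fin using (Fin; toℕ)
import Data.Integer as ℤ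
import Data.Integer.Properties as ℤ
open import Data.List using (List; []; _∷_; _++_; map; filter; length; concatMap; tabulate; allFin; applyUpTo; upTo)
open import Data.List.Properties using (map-++; map-∘; map-cong; map-tabulate)
open import Data.Nat
open import Data.Nat.Coprimality using (Coprime; coprime-Bézout; coprime-divisor)
open import Data.Nat.Divisibility
open import Data.Nat.DivMod using (_%_; _/_; m≡m%n+[m/n]*n; m%n<n; m/n≡1+[m∸n]/n; m/n*n≤m)
open import Data.Nat.GCD using (module Bézout)
open import Data.Nat.ListAction using (sum)
open import Data.Nat.ListAction.Properties using (sum-++)
open import Data.Nat.Primality using (Prime; prime⇒nonZero; prime⇒irreducible; irreducible[2]; ¬prime[1]; euclidsLemma)
open import Data.Nat.Properties
open import Data.Nat.Tactic.RingSolver using (solve-∀)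
open import Data.Product using (_×_; _,_; ∃-syntax)
open import Data.Sum using (inj₁; inj₂; [_,_]′)
open import Data.Vec as V using (Vec; []; _∷_; zipWith; replicate)
open import Data.Vec.Properties using (∷-injectiveˡ; ∷-injectiveʳ)
open import Data.Vec.Relation.Unary.All using (All; []; _∷_)
open import Data.Vec.Relation.Unary.Any as Any using (Any; here; there; any?)
open import Data.Vec.Relation.Unary.Any.Properties using (map⁺; map⁻)
open import Function using (_∘_; _$_; id)
open import Function.Bundles using (_⇔_; mk⇔; Equivalence)
open import Relation.Binary.PropositionalEquality
open import Relation.Nullary using (Dec; yes; no; does; ¬_; ¬?; contradiction)
open import Relation.Nullary.Decidable using (_×-dec_)
open import Relation.Unary using (Decidable)
open ≡-Reasoning

open import Defs

∑< : ℕ → (ℕ → ℕ) → ℕ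
∑< zero    f = 0
∑< (suc n) f = f 0 + ∑< n (f ∘ suc)

syntax ∑< n (λ i → e) = ∑[ i < n ] e

∑-cong-< : ∀ n {f g : ℕ → ℕ} → (∀ {a} → a < n → f a ≡ g a) → ∑< n f ≡ ∑< n g
∑-cong-< zero    f≡g = refl
∑-cong-< (suc n) f≡g = cong₂ _+_ (f≡g z<s) (∑-cong-< n (f≡g ∘ s<s))

∑-cong : ∀ n {f g : ℕ → ℕ} → (∀ a → f a ≡ g a) → ∑< n f ≡ ∑< n g
∑-cong n f≡g = ∑-cong-< n (λ {a} _ → f≡g a)

∑-distrib-+ : ∀ n (f g : ℕ → ℕ) → ∑[ a < n ] (f a + g a) ≡ ∑< n f + ∑< n g
∑-distrib-+ zero    f g = refl
∑-distrib-+ (suc n) f g = begin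
  (f 0 + g 0) + ∑[ a < n ] (f (suc a) + g (suc a)) ≡⟨ cong (f 0 + g 0 +_) (∑-distrib-+ n (f ∘ suc) (g ∘ suc)) ⟩
  (f 0 + g 0) + (∑< n (f ∘ suc) + ∑< n (g ∘ suc))  ≡⟨ +-comm-middle (f 0) (g 0) _ _ ⟩
  (f 0 + ∑< n (f ∘ suc)) + (g 0 + ∑< n (g ∘ suc))  ∎
  where
  +-comm-middle : ∀ a b c d → (a + b) + (c + d) ≡ (a + c) + (b + d)
  +-comm-middle = solve-∀

*-distribˡ-∑ : ∀ n c (f : ℕ → ℕ) → ∑[ a < n ] (c * f a) ≡ c * ∑< n f
*-distribˡ-∑ zero    c f = sym (*-zeroʳ c)
*-distribˡ-∑ (suc n) c f =
  trans (cong (c * f 0 +_) (*-distribˡ-∑ n c (f ∘ suc))) (sym (*-distribˡ-+ c (f 0) _))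

∑-const : ∀ n c → ∑[ _ < n ] c ≡ n * c
∑-const zero    c = refl
∑-const (suc n) c = cong (c +_) (∑-const n c)

∑-zero : ∀ n {f : ℕ → ℕ} → (∀ {a} → a < n → f a ≡ 0) → ∑< n f ≡ 0
∑-zero n f≡0 = trans (∑-cong-< n f≡0) (trans (∑-const n 0) (*-zeroʳ n))

∑-single : ∀ n {a₀} (f : ℕ → ℕ) → a₀ < n → (∀ {a} → a < n → a ≢ a₀ → f a ≡ 0) → ∑< n f ≡ f a₀
∑-single (suc n) {zero}   f _ f≡0 =
  trans (cong (f 0 +_) (∑-zero n (λ a<n → f≡0 (s<s a<n) λ ()))) (+-identityʳ _)
∑-single (suc n) {suc a₀} f (s<s a₀<n) f≡0 =
  trans (cong (_+ ∑< n (f ∘ suc)) (f≡0 z<s λ ()))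
        (∑-single n (f ∘ suc) a₀<n (λ a<n a≢a₀ → f≡0 (s<s a<n) (a≢a₀ ∘ suc-injective)))

∑-comm : ∀ m n (g : ℕ → ℕ → ℕ) → ∑[ a < m ] ∑[ b < n ] g a b ≡ ∑[ b < n ] ∑[ a < m ] g a b
∑-comm zero    n g = sym (∑-zero n (λ _ → refl))
∑-comm (suc m) n g = begin
  ∑< n (g 0) + ∑[ a < m ] ∑< n (g (suc a))         ≡⟨ cong (∑< n (g 0) +_) (∑-comm m n (g ∘ suc)) ⟩
  ∑< n (g 0) + ∑[ b < n ] ∑[ a < m ] g (suc a) b   ≡⟨ ∑-distrib-+ n (g 0) _ ⟨
  ∑[ b < n ] ∑[ a < suc m ] g a b                  ∎

∑-+ : ∀ m n (f : ℕ → ℕ) → ∑< (m + n) f ≡ ∑< m f + ∑[ a < n ] f (m + a)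
∑-+ zero    n f = refl
∑-+ (suc m) n f = trans (cong (f 0 +_) (∑-+ m n (f ∘ suc))) (sym (+-assoc (f 0) _ _))

∑-* : ∀ m n (f : ℕ → ℕ) → ∑< (m * n) f ≡ ∑[ a < m ] ∑[ b < n ] f (a * n + b)
∑-* zero    n f = refl
∑-* (suc m) n f = begin
  ∑< (n + m * n) f                                         ≡⟨ ∑-+ n (m * n) f ⟩
  ∑< n f + ∑[ c < m * n ] f (n + c)                        ≡⟨ cong (∑< n f +_) (∑-* m n (f ∘ (n +_))) ⟩
  ∑< n f + ∑[ a < m ] ∑[ b < n ] f (n + (a * n + b))       ≡⟨ cong (∑< n f +_) (∑-cong m λ a → ∑-cong n λ b →
                                                                cong f (sym (+-assoc n (a * n) b))) ⟩
  ∑< n f + ∑[ a < m ] ∑[ b < n ] f (suc a * n + b)         ∎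

∑ᵛ : ℕ → (k : ℕ) → (Vec ℕ k → ℕ) → ℕ
∑ᵛ n zero    f = f []
∑ᵛ n (suc k) f = ∑[ a < n ] ∑ᵛ n k (λ v → f (a ∷ v))

syntax ∑ᵛ n k (λ v → e) = ∑[ v ∈ [ n ]^ k ] e

∑ᵛ-cong-< : ∀ n k {f g : Vec ℕ k → ℕ} → (∀ {v} → All (_< n) v → f v ≡ g v) → ∑ᵛ n k f ≡ ∑ᵛ n k g
∑ᵛ-cong-< n zero    f≡g = f≡g []
∑ᵛ-cong-< n (suc k) f≡g = ∑-cong-< n (λ a<n → ∑ᵛ-cong-< n k (λ v<n → f≡g (a<n ∷ v<n)))

∑ᵛ-cong : ∀ n k {f g : Vec ℕ k → ℕ} → (∀ v → f v ≡ g v) → ∑ᵛ n k f ≡ ∑ᵛ n k g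
∑ᵛ-cong n k f≡g = ∑ᵛ-cong-< n k (λ {v} _ → f≡g v)

∑ᵛ-distrib-+ : ∀ n k (f g : Vec ℕ k → ℕ) → ∑[ v ∈ [ n ]^ k ] (f v + g v) ≡ ∑ᵛ n k f + ∑ᵛ n k g
∑ᵛ-distrib-+ n zero    f g = refl
∑ᵛ-distrib-+ n (suc k) f g =
  trans (∑-cong n (λ a → ∑ᵛ-distrib-+ n k (f ∘ (a ∷_)) (g ∘ (a ∷_)))) (∑-distrib-+ n _ _)

*-distribˡ-∑ᵛ : ∀ n k c (f : Vec ℕ k → ℕ) → ∑[ v ∈ [ n ]^ k ] (c * f v) ≡ c * ∑ᵛ n k f
*-distribˡ-∑ᵛ n zero    c f = refl
*-distribˡ-∑ᵛ n (suc k) c f =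
  trans (∑-cong n (λ a → *-distribˡ-∑ᵛ n k c (f ∘ (a ∷_)))) (*-distribˡ-∑ n c _)

∑ᵛ-const : ∀ n k c → ∑[ _ ∈ [ n ]^ k ] c ≡ n ^ k * c
∑ᵛ-const n zero    c = sym (+-identityʳ c)
∑ᵛ-const n (suc k) c = begin
  ∑[ _ < n ] ∑[ _ ∈ [ n ]^ k ] c ≡⟨ ∑-cong n (λ _ → ∑ᵛ-const n k c) ⟩
  ∑[ _ < n ] (n ^ k * c)         ≡⟨ ∑-const n _ ⟩
  n * (n ^ k * c)                ≡⟨ *-assoc n _ c ⟨
  n * n ^ k * c                  ∎

∑ᵛ-zero : ∀ n k {f : Vec ℕ k → ℕ} → (∀ {v} → All (_< n) v → f v ≡ 0) → ∑ᵛ n k f ≡ 0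
∑ᵛ-zero n k f≡0 = trans (∑ᵛ-cong-< n k f≡0) (trans (∑ᵛ-const n k 0) (*-zeroʳ (n ^ k)))

∑ᵛ-[1]-const : ∀ k c → ∑[ _ ∈ [ 1 ]^ k ] c ≡ c
∑ᵛ-[1]-const k c = trans (∑ᵛ-const 1 k c) (trans (cong (_* c) (^-zeroˡ k)) (*-identityˡ c))

0ᵛ : ∀ k → Vec ℕ k
0ᵛ k = replicate k 0

∑ᵛ-single : ∀ n k (f : Vec ℕ k → ℕ) → 0 < n →
            (∀ {v} → All (_< n) v → v ≢ 0ᵛ k → f v ≡ 0) → ∑ᵛ n k f ≡ f (0ᵛ k)
∑ᵛ-single n zero    f _   _   = refl
∑ᵛ-single n (suc k) f 0<n f≡0 =
  trans (∑-single n _ 0<n λ a<n a≢0 → ∑ᵛ-zero n k λ v<n → f≡0 (a<n ∷ v<n) (a≢0 ∘ ∷-injectiveˡ))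
        (∑ᵛ-single n k (f ∘ (0 ∷_)) 0<n λ v<n v≢0 → f≡0 (0<n ∷ v<n) (v≢0 ∘ ∷-injectiveʳ))

∑-∑ᵛ-comm : ∀ m n k (g : ℕ → Vec ℕ k → ℕ) →
            ∑[ a < m ] ∑[ v ∈ [ n ]^ k ] g a v ≡ ∑[ v ∈ [ n ]^ k ] ∑[ a < m ] g a v
∑-∑ᵛ-comm m n zero    g = refl
∑-∑ᵛ-comm m n (suc k) g = begin
  ∑[ a < m ] ∑[ b < n ] ∑[ v ∈ [ n ]^ k ] g a (b ∷ v) ≡⟨ ∑-comm m n _ ⟩
  ∑[ b < n ] ∑[ a < m ] ∑[ v ∈ [ n ]^ k ] g a (b ∷ v) ≡⟨ ∑-cong n (λ b → ∑-∑ᵛ-comm m n k (λ a → g a ∘ (b ∷_))) ⟩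
  ∑[ b < n ] ∑[ v ∈ [ n ]^ k ] ∑[ a < m ] g a (b ∷ v) ∎

∑ᵛ-comm : ∀ m n k (g : Vec ℕ k → Vec ℕ k → ℕ) →
          ∑[ z ∈ [ m ]^ k ] ∑[ y ∈ [ n ]^ k ] g z y ≡ ∑[ y ∈ [ n ]^ k ] ∑[ z ∈ [ m ]^ k ] g z y
∑ᵛ-comm m n zero    g = refl
∑ᵛ-comm m n (suc k) g = begin
  ∑[ a < m ] ∑[ z ∈ [ m ]^ k ] ∑[ b < n ] ∑[ y ∈ [ n ]^ k ] G a b z y
    ≡⟨ ∑-cong m (λ a → ∑-∑ᵛ-comm n m k (λ b z → ∑ᵛ n k (G a b z))) ⟨
  ∑[ a < m ] ∑[ b < n ] ∑[ z ∈ [ m ]^ k ] ∑[ y ∈ [ n ]^ k ] G a b z y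
    ≡⟨ ∑-cong m (λ a → ∑-cong n (λ b → ∑ᵛ-comm m n k (G a b))) ⟩
  ∑[ a < m ] ∑[ b < n ] ∑[ y ∈ [ n ]^ k ] ∑[ z ∈ [ m ]^ k ] G a b z y
    ≡⟨ ∑-comm m n _ ⟩
  ∑[ b < n ] ∑[ a < m ] ∑[ y ∈ [ n ]^ k ] ∑[ z ∈ [ m ]^ k ] G a b z y
    ≡⟨ ∑-cong n (λ b → ∑-∑ᵛ-comm m n k (λ a y → ∑ᵛ m k (λ z → G a b z y))) ⟩
  ∑[ b < n ] ∑[ y ∈ [ n ]^ k ] ∑[ a < m ] ∑[ z ∈ [ m ]^ k ] G a b z y ∎
  where
  G : ℕ → ℕ → Vec ℕ k → Vec ℕ k → ℕ
  G a b z y = g (a ∷ z) (b ∷ y)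

_·[_]+_ : ∀ {k} → Vec ℕ k → ℕ → Vec ℕ k → Vec ℕ k
z ·[ m ]+ y = zipWith (λ a b → a * m + b) z y

∑ᵛ-* : ∀ m n k (f : Vec ℕ k → ℕ) →
       ∑ᵛ (m * n) k f ≡ ∑[ z ∈ [ m ]^ k ] ∑[ y ∈ [ n ]^ k ] f (z ·[ n ]+ y)
∑ᵛ-* m n zero    f = refl
∑ᵛ-* m n (suc k) f = begin
  ∑[ c < m * n ] ∑[ v ∈ [ m * n ]^ k ] f (c ∷ v)
    ≡⟨ ∑-cong (m * n) (λ c → ∑ᵛ-* m n k (f ∘ (c ∷_))) ⟩
  ∑[ c < m * n ] ∑[ z ∈ [ m ]^ k ] ∑[ y ∈ [ n ]^ k ] f (c ∷ z ·[ n ]+ y)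
    ≡⟨ ∑-* m n _ ⟩
  ∑[ a < m ] ∑[ b < n ] ∑[ z ∈ [ m ]^ k ] ∑[ y ∈ [ n ]^ k ] f ((a * n + b) ∷ z ·[ n ]+ y)
    ≡⟨ ∑-cong m (λ a → ∑-∑ᵛ-comm n m k (λ b z → ∑ᵛ n k (λ y → f ((a * n + b) ∷ z ·[ n ]+ y)))) ⟩
  ∑[ a < m ] ∑[ z ∈ [ m ]^ k ] ∑[ b < n ] ∑[ y ∈ [ n ]^ k ] f ((a * n + b) ∷ z ·[ n ]+ y) ∎

𝟙 : ∀ {P : Set} → Dec P → ℕ
𝟙 d = if does d then 1 else 0

𝟙-yes : ∀ {P : Set} (d : Dec P) → P → 𝟙 d ≡ 1
𝟙-yes (yes _) _ = refl
𝟙-yes (no ¬p) p = contradiction p ¬p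

𝟙-no : ∀ {P : Set} (d : Dec P) → ¬ P → 𝟙 d ≡ 0
𝟙-no (yes p) ¬p = contradiction p ¬p
𝟙-no (no _)  _  = refl

𝟙-cong : ∀ {P Q : Set} (d : Dec P) (e : Dec Q) → P ⇔ Q → 𝟙 d ≡ 𝟙 e
𝟙-cong d (yes q) P⇔Q = 𝟙-yes d (Equivalence.from P⇔Q q)
𝟙-cong d (no ¬q) P⇔Q = 𝟙-no d (¬q ∘ Equivalence.to P⇔Q)

𝟙-×-dec : ∀ {P Q : Set} (d : Dec P) (e : Dec Q) → 𝟙 (d ×-dec e) ≡ 𝟙 d * 𝟙 e
𝟙-×-dec (yes _) (yes _) = refl
𝟙-×-dec (yes _) (no _)  = refl
𝟙-×-dec (no _)  _       = refl

𝟙-split : ∀ {P Q : Set} (d : Dec P) (e : Dec Q) → 𝟙 d ≡ 𝟙 d * 𝟙 e + 𝟙 d * 𝟙 (¬? e)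
𝟙-split (yes _) (yes _) = refl
𝟙-split (yes _) (no _)  = refl
𝟙-split (no _)  _       = refl

𝟙-*-cong : ∀ {P : Set} (d : Dec P) {a b} → (P → a ≡ b) → 𝟙 d * a ≡ 𝟙 d * b
𝟙-*-cong (yes p) a≡b = cong (1 *_) (a≡b p)
𝟙-*-cong (no _)  _   = refl

length-filter≡sum-𝟙 : ∀ {A : Set} {P : A → Set} (P? : Decidable P) (xs : List A) →
                      length (filter P? xs) ≡ sum (map (𝟙 ∘ P?) xs)
length-filter≡sum-𝟙 P? []       = refl
length-filter≡sum-𝟙 P? (x ∷ xs) with does (P? x)
... | false = length-filter≡sum-𝟙 P? xs
... | true  = cong suc (length-filter≡sum-𝟙 P? xs)

sum-map-concatMap : ∀ {A B : Set} (g : B → ℕ) (h : A → List B) (xs : List A) →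
                    sum (map g (concatMap h xs)) ≡ sum (map (sum ∘ map g ∘ h) xs)
sum-map-concatMap g h []       = refl
sum-map-concatMap g h (x ∷ xs) = begin
  sum (map g (h x ++ concatMap h xs))               ≡⟨ cong sum (map-++ g (h x) _) ⟩
  sum (map g (h x) ++ map g (concatMap h xs))       ≡⟨ sum-++ (map g (h x)) _ ⟩
  sum (map g (h x)) + sum (map g (concatMap h xs))  ≡⟨ cong (sum (map g (h x)) +_) (sum-map-concatMap g h xs) ⟩
  sum (map g (h x)) + sum (map (sum ∘ map g ∘ h) xs) ∎

sum-tabulate : ∀ n (f : ℕ → ℕ) → sum (tabulate {n = n} (f ∘ toℕ)) ≡ ∑< n f
sum-tabulate zero    f = refl
sum-tabulate (suc n) f = cong (f 0 +_) (sum-tabulate n (f ∘ suc))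

sum-tuples : ∀ n k (g : Vec ℕ k → ℕ) → sum (map (g ∘ V.map toℕ) (tuples n k)) ≡ ∑ᵛ n k g
sum-tuples n zero    g = +-identityʳ (g [])
sum-tuples n (suc k) g = begin
  sum (map G (concatMap (λ x → map (x ∷_) (tuples n k)) (allFin n)))
    ≡⟨ sum-map-concatMap G _ (allFin n) ⟩
  sum (map (λ x → sum (map G (map (x ∷_) (tuples n k)))) (allFin n))
    ≡⟨ cong sum (map-cong (λ x → trans (cong sum (sym (map-∘ (tuples n k))))
                                       (sum-tuples n k (g ∘ (toℕ x ∷_)))) (allFin n)) ⟩
  sum (map (λ x → ∑ᵛ n k (g ∘ (toℕ x ∷_))) (allFin n))
    ≡⟨ cong sum (map-tabulate {n = n} id _) ⟩
  sum (tabulate {n = n} (λ x → ∑ᵛ n k (g ∘ (toℕ x ∷_))))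
    ≡⟨ sum-tabulate n (λ a → ∑ᵛ n k (g ∘ (a ∷_))) ⟩
  ∑[ a < n ] ∑ᵛ n k (g ∘ (a ∷_)) ∎
  where
  G : Vec (Fin n) (suc k) → ℕ
  G = g ∘ V.map toℕ

count-tuples : ∀ n k {P : Vec (Fin n) k → Set} (P? : Decidable P) (g : Vec ℕ k → ℕ) →
               (∀ v → 𝟙 (P? v) ≡ g (V.map toℕ v)) → length (filter P? (tuples n k)) ≡ ∑ᵛ n k g
count-tuples n k P? g 𝟙P≡g = begin
  length (filter P? (tuples n k))        ≡⟨ length-filter≡sum-𝟙 P? (tuples n k) ⟩
  sum (map (𝟙 ∘ P?) (tuples n k))        ≡⟨ cong sum (map-cong 𝟙P≡g (tuples n k)) ⟩
  sum (map (g ∘ V.map toℕ) (tuples n k)) ≡⟨ sum-tuples n k g ⟩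
  ∑ᵛ n k g                               ∎

‖_‖² : ∀ {k} → Vec ℕ k → ℕ
‖ []    ‖² = 0
‖ x ∷ v ‖² = x * x + ‖ v ‖²

sumSq≡‖toℕ‖² : ∀ {n k} (v : Vec (Fin n) k) → sumSq v ≡ ‖ V.map toℕ v ‖²
sumSq≡‖toℕ‖² []      = refl
sumSq≡‖toℕ‖² (x ∷ v) = cong (toℕ x * toℕ x +_) (sumSq≡‖toℕ‖² v)

Primitive : ℕ → ∀ {k} → Vec ℕ k → Set
Primitive p = Any (λ x → ¬ p ∣ x)

primitive? : ∀ p {k} (v : Vec ℕ k) → Dec (Primitive p v)
primitive? p = any? (λ x → ¬? (p ∣? x))

∣m+n⇔∣m : ∀ {d} m {n} → d ∣ n → d ∣ m + n ⇔ d ∣ m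
∣m+n⇔∣m {d} m {n} d∣n =
  mk⇔ (λ d∣m+n → ∣m+n∣m⇒∣n (subst (d ∣_) (+-comm m n) d∣m+n) d∣n) (λ d∣m → ∣m∣n⇒∣m+n d∣m d∣n)

∣m+n⇔∣n : ∀ {d} {m} n → d ∣ m → d ∣ m + n ⇔ d ∣ n
∣m+n⇔∣n {d} {m} n d∣m = subst (λ x → d ∣ x ⇔ d ∣ n) (+-comm n m) (∣m+n⇔∣m n d∣m)

∣∣s-m∣⇔∣s : ∀ {d} s m → d ∣ m → d ∣ ℤ.∣ ℤ.+ s ℤ.- ℤ.+ m ∣ ⇔ d ∣ s
∣∣s-m∣⇔∣s {d} s m d∣m with ≤-total m s
... | inj₁ m≤s = subst (λ x → d ∣ x ⇔ d ∣ s) (sym ∣s-m∣≡s∸m)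
  (mk⇔ (λ d∣s∸m → ∣m∸n∣n⇒∣m d m≤s d∣s∸m d∣m)
       (λ d∣s → ∣m+n∣m⇒∣n (subst (d ∣_) (sym (m+[n∸m]≡n m≤s)) d∣s) d∣m))
  where
  ∣s-m∣≡s∸m : ℤ.∣ ℤ.+ s ℤ.- ℤ.+ m ∣ ≡ s ∸ m
  ∣s-m∣≡s∸m = trans (cong ℤ.∣_∣ (ℤ.[+m]-[+n]≡m⊖n s m)) (trans (ℤ.∣m⊖n∣≡∣n⊖m∣ s m) (ℤ.∣⊖∣-≤ m≤s))
... | inj₂ s≤m = subst (λ x → d ∣ x ⇔ d ∣ s) (sym ∣s-m∣≡m∸s)
  (mk⇔ (∣m+n∣m⇒∣n (subst (d ∣_) (sym (m∸n+n≡m s≤m)) d∣m))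
       (∣m+n∣m⇒∣n (subst (d ∣_) (sym (m+[n∸m]≡n s≤m)) d∣m)))
  where
  ∣s-m∣≡m∸s : ℤ.∣ ℤ.+ s ℤ.- ℤ.+ m ∣ ≡ m ∸ s
  ∣s-m∣≡m∸s = trans (cong ℤ.∣_∣ (ℤ.[+m]-[+n]≡m⊖n s m)) (ℤ.∣⊖∣-≤ s≤m)

∣∣sumSq-m∣⇔∣‖toℕ‖² : ∀ {d n k} m (v : Vec (Fin n) k) → d ∣ m →
                 d ∣ ℤ.∣ ℤ.+ sumSq v ℤ.- ℤ.+ m ∣ ⇔ d ∣ ‖ V.map toℕ v ‖²
∣∣sumSq-m∣⇔∣‖toℕ‖² {d} m v d∣m =
  subst (λ x → d ∣ ℤ.∣ ℤ.+ sumSq v ℤ.- ℤ.+ m ∣ ⇔ d ∣ x) (sumSq≡‖toℕ‖² v) (∣∣s-m∣⇔∣s (sumSq v) m d∣m)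

ρ≡∑ : ∀ k n → ρ k (ℤ.+ 0) n ≡ ∑[ v ∈ [ n ]^ k ] 𝟙 (n ∣? ‖ v ‖²)
ρ≡∑ k n = count-tuples n k _ _ λ v → 𝟙-cong (n ∣? _) (n ∣? _) (∣∣sumSq-m∣⇔∣‖toℕ‖² 0 v (n ∣0))

ρ⁽¹⁾≡∑ : ∀ k p m → p ^ 1 ∣ m →
         ρ⁽¹⁾ k (ℤ.+ m) p 1 ≡ ∑[ v ∈ [ p ^ 1 ]^ k ] (𝟙 (p ^ 1 ∣? ‖ v ‖²) * 𝟙 (primitive? p v))
ρ⁽¹⁾≡∑ k p m p∣m = count-tuples (p ^ 1) k _ _ λ v → trans
  (𝟙-×-dec (p ^ 1 ∣? _) (any? _ v))
  (cong₂ _*_ (𝟙-cong (p ^ 1 ∣? _) (p ^ 1 ∣? _) (∣∣sumSq-m∣⇔∣‖toℕ‖² m v p∣m))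
             (𝟙-cong (any? _ v) (primitive? p (V.map toℕ v)) (mk⇔ map⁺ map⁻)))

prime∤⇒coprime : ∀ {p u} → Prime p → ¬ p ∣ u → Coprime p u
prime∤⇒coprime p-prime p∤u (d∣p , d∣u) with prime⇒irreducible p-prime d∣p
... | inj₁ d≡1 = d≡1
... | inj₂ refl = contradiction d∣u p∤u

∣∧<⇒≡0 : ∀ {p x} → p ∣ x → x < p → x ≡ 0
∣∧<⇒≡0 {x = zero}  _   _   = refl
∣∧<⇒≡0 {x = suc _} p∣x x<p = contradiction (∣⇒≤ p∣x) (<⇒≱ x<p)

prime∤* : ∀ {p m n} → Prime p → ¬ p ∣ m → ¬ p ∣ n → ¬ p ∣ m * n
prime∤* {m = m} {n} p-prime p∤m p∤n = [ p∤m , p∤n ]′ ∘ euclidsLemma m n p-prime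

odd-prime∤2 : ∀ {p} → Prime p → ¬ 2 ∣ p → ¬ p ∣ 2
odd-prime∤2 p-prime 2∤p p∣2 with irreducible[2] p∣2
... | inj₁ refl = ¬prime[1] p-prime
... | inj₂ refl = 2∤p ∣-refl

dot : ∀ {k} → Vec ℕ k → Vec ℕ k → ℕ
dot []      []      = 0
dot (a ∷ y) (b ∷ z) = a * b + dot y z

dot-*ˡ : ∀ {k} c (y z : Vec ℕ k) → dot (V.map (c *_) y) z ≡ c * dot y z
dot-*ˡ c []      []      = sym (*-zeroʳ c)
dot-*ˡ c (a ∷ y) (b ∷ z) = begin
  c * a * b + dot (V.map (c *_) y) z ≡⟨ cong (c * a * b +_) (dot-*ˡ c y z) ⟩
  c * a * b + c * dot y z            ≡⟨ cong (_+ c * dot y z) (*-assoc c a b) ⟩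
  c * (a * b) + c * dot y z          ≡⟨ *-distribˡ-+ c (a * b) _ ⟨
  c * (a * b + dot y z)              ∎

module _ {p} (p-prime : Prime p) where

  private instance
    p≢0 : NonZero p
    p≢0 = prime⇒nonZero p-prime

  -- Bézout gives 1 + y u = x p or 1 + x p = y u; in the second case (p − 1) y does the job.
  ∃[1+u*y]divisible : ∀ {u} → ¬ p ∣ u → ∃[ y ] p ∣ 1 + u * y
  ∃[1+u*y]divisible {u} p∤u with coprime-Bézout (prime∤⇒coprime p-prime p∤u)
  ... | Bézout.+- x y 1+yu≡xp = y , divides x (trans (cong (1 +_) (*-comm u y)) 1+yu≡xp)
  ... | Bézout.-+ x y 1+xp≡yu = q * y , divides (1 + q * x) (begin
    1 + u * (q * y)     ≡⟨ cong (1 +_) (rearrange u q y) ⟩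
    1 + q * (y * u)     ≡⟨ cong (λ w → 1 + q * w) 1+xp≡yu ⟨
    1 + q * (1 + x * p) ≡⟨ expand q x p ⟩
    suc q + q * x * p   ≡⟨ cong (_+ q * x * p) (suc-pred p) ⟩
    p + q * x * p       ≡⟨ factor p q x ⟩
    (1 + q * x) * p     ∎)
    where
    q = pred p
    rearrange : ∀ u q y → u * (q * y) ≡ q * (y * u)
    rearrange = solve-∀
    expand : ∀ q x p → 1 + q * (1 + x * p) ≡ suc q + q * x * p
    expand = solve-∀
    factor : ∀ p q x → p + q * x * p ≡ (1 + q * x) * p
    factor = solve-∀

  ∃-solution : ∀ d {u} → ¬ p ∣ u → ∃[ z ] z < p × p ∣ d + u * z
  ∃-solution d {u} p∤u with ∃[1+u*y]divisible p∤u
  ... | y , p∣1+uy = w % p , m%n<n w p ,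
        Equivalence.to (∣m+n⇔∣m (d + u * (w % p)) (n∣m*n (u * (w / p))))
                       (subst (p ∣_) reduce (p∣d+uw))
    where
    w = d * y
    p∣d+uw : p ∣ d + u * w
    p∣d+uw = subst (p ∣_) (distribute d u y) (∣n⇒∣m*n d p∣1+uy)
      where
      distribute : ∀ d u y → d * (1 + u * y) ≡ d + u * (d * y)
      distribute = solve-∀
    reduce : d + u * w ≡ d + u * (w % p) + u * (w / p) * p
    reduce = begin
      d + u * w                              ≡⟨ cong (λ v → d + u * v) (m≡m%n+[m/n]*n w p) ⟩
      d + u * (w % p + w / p * p)            ≡⟨ expand d u (w % p) (w / p) p ⟩
      d + u * (w % p) + u * (w / p) * p      ∎
      where
      expand : ∀ d u r q p → d + u * (r + q * p) ≡ d + u * r + u * q * p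
      expand = solve-∀

  solution-unique-≤ : ∀ d {u a b} → ¬ p ∣ u → a ≤ b → b < p →
                      p ∣ d + u * a → p ∣ d + u * b → a ≡ b
  solution-unique-≤ d {u} {a} {b} p∤u a≤b b<p p∣d+ua p∣d+ub = ≤-antisym a≤b (m∸n≡0⇒m≤n b∸a≡0)
    where
    split : d + u * b ≡ (d + u * a) + u * (b ∸ a)
    split = begin
      d + u * b                 ≡⟨ cong (λ c → d + u * c) (m+[n∸m]≡n a≤b) ⟨
      d + u * (a + (b ∸ a))     ≡⟨ expand d u a (b ∸ a) ⟩
      (d + u * a) + u * (b ∸ a) ∎
      where
      expand : ∀ d u a c → d + u * (a + c) ≡ (d + u * a) + u * c
      expand = solve-∀
    p∣b∸a : p ∣ b ∸ a
    p∣b∸a = coprime-divisor (prime∤⇒coprime p-prime p∤u) (∣m+n∣m⇒∣n (subst (p ∣_) split p∣d+ub) p∣d+ua)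
    b∸a≡0 : b ∸ a ≡ 0
    b∸a≡0 = ∣∧<⇒≡0 p∣b∸a (≤-<-trans (m∸n≤m b a) b<p)

  solution-unique : ∀ d {u a b} → ¬ p ∣ u → a < p → b < p →
                    p ∣ d + u * a → p ∣ d + u * b → a ≡ b
  solution-unique d {a = a} {b} p∤u a<p b<p p∣d+ua p∣d+ub with ≤-total a b
  ... | inj₁ a≤b = solution-unique-≤ d p∤u a≤b b<p p∣d+ua p∣d+ub
  ... | inj₂ b≤a = sym (solution-unique-≤ d p∤u b≤a a<p p∣d+ub p∣d+ua)

  ∑-linear-congruence : ∀ d {u} → ¬ p ∣ u → ∑[ z < p ] 𝟙 (p ∣? d + u * z) ≡ 1
  ∑-linear-congruence d {u} p∤u =
    let z₀ , z₀<p , p∣d+uz₀ = ∃-solution d p∤u in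
    trans (∑-single p (λ z → 𝟙 (p ∣? d + u * z)) z₀<p λ z<p z≢z₀ →
             𝟙-no (p ∣? _) (z≢z₀ ∘ λ p∣d+uz → solution-unique d p∤u z<p z₀<p p∣d+uz p∣d+uz₀))
          (𝟙-yes (p ∣? d + u * z₀) p∣d+uz₀)

  ∑-hyperplane : ∀ {k} (a : Vec ℕ k) c → Primitive p a →
                 ∑[ z ∈ [ p ]^ k ] 𝟙 (p ∣? c + dot a z) ≡ p ^ (k ∸ 1)
  ∑-hyperplane {suc k} (a₀ ∷ a) c (here p∤a₀) = begin
    ∑[ b < p ] ∑[ z ∈ [ p ]^ k ] 𝟙 (p ∣? c + (a₀ * b + dot a z))
      ≡⟨ ∑-∑ᵛ-comm p p k _ ⟩
    ∑[ z ∈ [ p ]^ k ] ∑[ b < p ] 𝟙 (p ∣? c + (a₀ * b + dot a z))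
      ≡⟨ ∑ᵛ-cong p k (λ z → ∑-cong p λ b → cong (𝟙 ∘ (p ∣?_)) (rearrange c a₀ b (dot a z))) ⟩
    ∑[ z ∈ [ p ]^ k ] ∑[ b < p ] 𝟙 (p ∣? (c + dot a z) + a₀ * b)
      ≡⟨ ∑ᵛ-cong p k (λ z → ∑-linear-congruence (c + dot a z) p∤a₀) ⟩
    ∑[ _ ∈ [ p ]^ k ] 1
      ≡⟨ ∑ᵛ-const p k 1 ⟩
    p ^ k * 1
      ≡⟨ *-identityʳ _ ⟩
    p ^ k ∎
    where
    rearrange : ∀ c a₀ b d → c + (a₀ * b + d) ≡ (c + d) + a₀ * b
    rearrange = solve-∀
  ∑-hyperplane {suc (suc k)} (a₀ ∷ a) c (there primitive-a) = begin
    ∑[ b < p ] ∑[ z ∈ [ p ]^ suc k ] 𝟙 (p ∣? c + (a₀ * b + dot a z))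
      ≡⟨ ∑-cong p (λ b → ∑ᵛ-cong p (suc k) λ z → cong (𝟙 ∘ (p ∣?_)) (sym (+-assoc c (a₀ * b) (dot a z)))) ⟩
    ∑[ b < p ] ∑[ z ∈ [ p ]^ suc k ] 𝟙 (p ∣? (c + a₀ * b) + dot a z)
      ≡⟨ ∑-cong p (λ b → ∑-hyperplane a (c + a₀ * b) primitive-a) ⟩
    ∑[ _ < p ] (p ^ k)
      ≡⟨ ∑-const p _ ⟩
    p * p ^ k ∎

‖z·[m]+y‖² : ∀ {k} m (z y : Vec ℕ k) → ‖ z ·[ m ]+ y ‖² ≡ ‖ y ‖² + m * (2 * dot y z + m * ‖ z ‖²)
‖z·[m]+y‖² m []      []      = sym (trans (cong (m *_) (*-zeroʳ m)) (*-zeroʳ m))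
‖z·[m]+y‖² m (b ∷ z) (a ∷ y) = begin
  (b * m + a) * (b * m + a) + ‖ z ·[ m ]+ y ‖²
    ≡⟨ cong ((b * m + a) * (b * m + a) +_) (‖z·[m]+y‖² m z y) ⟩
  (b * m + a) * (b * m + a) + (‖ y ‖² + m * (2 * dot y z + m * ‖ z ‖²))
    ≡⟨ expand b a m ‖ y ‖² (dot y z) ‖ z ‖² ⟩
  a * a + ‖ y ‖² + m * (2 * (a * b + dot y z) + m * (b * b + ‖ z ‖²)) ∎
  where
  expand : ∀ b a m sy d sz → (b * m + a) * (b * m + a) + (sy + m * (2 * d + m * sz))
                           ≡ a * a + sy + m * (2 * (a * b + d) + m * (b * b + sz))
  expand = solve-∀

‖z·[m]+0‖² : ∀ {k} m (z : Vec ℕ k) → ‖ z ·[ m ]+ 0ᵛ k ‖² ≡ m * (m * ‖ z ‖²)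
‖z·[m]+0‖² m []      = sym (trans (cong (m *_) (*-zeroʳ m)) (*-zeroʳ m))
‖z·[m]+0‖² m (b ∷ z) = begin
  (b * m + 0) * (b * m + 0) + ‖ z ·[ m ]+ 0ᵛ _ ‖²  ≡⟨ cong ((b * m + 0) * (b * m + 0) +_) (‖z·[m]+0‖² m z) ⟩
  (b * m + 0) * (b * m + 0) + m * (m * ‖ z ‖²)     ≡⟨ expand b m ‖ z ‖² ⟩
  m * (m * (b * b + ‖ z ‖²))                       ∎
  where
  expand : ∀ b m s → (b * m + 0) * (b * m + 0) + m * (m * s) ≡ m * (m * (b * b + s))
  expand = solve-∀

primitive-·[]+⇔ : ∀ {p m k} → p ∣ m → (z y : Vec ℕ k) → Primitive p (z ·[ m ]+ y) ⇔ Primitive p y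
primitive-·[]+⇔ p∣m []      []      = mk⇔ (λ ()) (λ ())
primitive-·[]+⇔ {p} {m} p∣m (b ∷ z) (a ∷ y) = mk⇔ to from
  where
  p∣bm+a⇔p∣a : p ∣ b * m + a ⇔ p ∣ a
  p∣bm+a⇔p∣a = ∣m+n⇔∣n a (∣n⇒∣m*n b p∣m)
  to : Primitive p (b * m + a ∷ z ·[ m ]+ y) → Primitive p (a ∷ y)
  to (here p∤bm+a) = here (p∤bm+a ∘ Equivalence.from p∣bm+a⇔p∣a)
  to (there prim)  = there (Equivalence.to (primitive-·[]+⇔ p∣m z y) prim)
  from : Primitive p (a ∷ y) → Primitive p (b * m + a ∷ z ·[ m ]+ y)
  from (here p∤a)   = here (p∤a ∘ Equivalence.to p∣bm+a⇔p∣a)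
  from (there prim) = there (Equivalence.from (primitive-·[]+⇔ p∣m z y) prim)

digits≢0⇒primitive : ∀ {p k} {y : Vec ℕ k} → All (_< p) y → y ≢ 0ᵛ k → Primitive p y
digits≢0⇒primitive {y = []}    []          y≢0 = contradiction refl y≢0
digits≢0⇒primitive {y = a ∷ y} (a<p ∷ y<p) y≢0 with a ≟ 0
... | yes refl = there (digits≢0⇒primitive y<p (y≢0 ∘ cong (0 ∷_)))
... | no  a≢0  = here λ p∣a → a≢0 (∣∧<⇒≡0 p∣a a<p)

¬primitive-0ᵛ : ∀ {p} k → ¬ Primitive p (0ᵛ k)
¬primitive-0ᵛ {p} (suc k) (here p∤0) = p∤0 (p ∣0)
¬primitive-0ᵛ     (suc k) (there prim) = ¬primitive-0ᵛ k prim

primitive-*ˡ : ∀ {p c k} → Prime p → ¬ p ∣ c → {y : Vec ℕ k} → Primitive p y → Primitive p (V.map (c *_) y)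
primitive-*ˡ p-prime p∤c = map⁺ ∘ Any.map (prime∤* p-prime p∤c)

∣‖z·[m]+y‖²⇔∣‖y‖² : ∀ {d m k} → d ∣ m → (z y : Vec ℕ k) → d ∣ ‖ z ·[ m ]+ y ‖² ⇔ d ∣ ‖ y ‖²
∣‖z·[m]+y‖²⇔∣‖y‖² {d} {m} d∣m z y = subst (λ x → d ∣ x ⇔ d ∣ ‖ y ‖²) (sym (‖z·[m]+y‖² m z y))
                                      (∣m+n⇔∣m ‖ y ‖² (∣m⇒∣m*n _ d∣m))

∑-periodic : ∀ c m k → ∑[ z ∈ [ c * m ]^ k ] 𝟙 (m ∣? ‖ z ‖²) ≡ c ^ k * ∑[ y ∈ [ m ]^ k ] 𝟙 (m ∣? ‖ y ‖²)
∑-periodic c m k = begin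
  ∑ᵛ (c * m) k F
    ≡⟨ ∑ᵛ-* c m k F ⟩
  ∑[ z ∈ [ c ]^ k ] ∑[ y ∈ [ m ]^ k ] F (z ·[ m ]+ y)
    ≡⟨ ∑ᵛ-cong c k (λ z → ∑ᵛ-cong m k λ y → 𝟙-cong (m ∣? _) (m ∣? _) (∣‖z·[m]+y‖²⇔∣‖y‖² ∣-refl z y)) ⟩
  ∑[ z ∈ [ c ]^ k ] ∑ᵛ m k F
    ≡⟨ ∑ᵛ-const c k _ ⟩
  c ^ k * ∑ᵛ m k F ∎
  where
  F : Vec ℕ k → ℕ
  F y = 𝟙 (m ∣? ‖ y ‖²)

module Counts {p} (p-prime : Prime p) (p-odd : ¬ 2 ∣ p) (k : ℕ) where

  instance
    p≢0 : NonZero p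
    p≢0 = prime⇒nonZero p-prime

  R P Q : ℕ → ℕ
  R t = ∑[ v ∈ [ p ^ t ]^ k ] 𝟙 (p ^ t ∣? ‖ v ‖²)
  P t = ∑[ v ∈ [ p ^ t ]^ k ] (𝟙 (p ^ t ∣? ‖ v ‖²) * 𝟙 (primitive? p v))
  Q t = ∑[ v ∈ [ p ^ t ]^ k ] (𝟙 (p ^ t ∣? ‖ v ‖²) * 𝟙 (¬? (primitive? p v)))

  R≡P+Q : ∀ t → R t ≡ P t + Q t
  R≡P+Q t = trans (∑ᵛ-cong (p ^ t) k λ v → 𝟙-split (p ^ t ∣? ‖ v ‖²) (primitive? p v))
                  (∑ᵛ-distrib-+ (p ^ t) k _ _)

  Q-digits : ∀ t → Q (1 + t) ≡ ∑[ z ∈ [ p ^ t ]^ k ] 𝟙 (p ^ (1 + t) ∣? p * (p * ‖ z ‖²))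
  Q-digits t = begin
    ∑ᵛ (p * p ^ t) k F
      ≡⟨ cong (λ n → ∑ᵛ n k F) (*-comm p (p ^ t)) ⟩
    ∑ᵛ (p ^ t * p) k F
      ≡⟨ ∑ᵛ-* (p ^ t) p k F ⟩
    ∑[ z ∈ [ p ^ t ]^ k ] ∑[ y ∈ [ p ]^ k ] F (z ·[ p ]+ y)
      ≡⟨ ∑ᵛ-cong (p ^ t) k (λ z → ∑ᵛ-single p k _ (>-nonZero⁻¹ p) (F-primitive z)) ⟩
    ∑[ z ∈ [ p ^ t ]^ k ] F (z ·[ p ]+ 0ᵛ k)
      ≡⟨ ∑ᵛ-cong (p ^ t) k F-0ᵛ ⟩
    ∑[ z ∈ [ p ^ t ]^ k ] 𝟙 (p ^ (1 + t) ∣? p * (p * ‖ z ‖²)) ∎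
    where
    F : Vec ℕ k → ℕ
    F v = 𝟙 (p ^ (1 + t) ∣? ‖ v ‖²) * 𝟙 (¬? (primitive? p v))
    F-primitive : ∀ z {y} → All (_< p) y → y ≢ 0ᵛ k → F (z ·[ p ]+ y) ≡ 0
    F-primitive z {y} y<p y≢0 = trans
      (cong (𝟙 (p ^ (1 + t) ∣? ‖ z ·[ p ]+ y ‖²) *_) (𝟙-no (¬? (primitive? p (z ·[ p ]+ y))) (_$ z·p+y-primitive)))
      (*-zeroʳ (𝟙 (p ^ (1 + t) ∣? ‖ z ·[ p ]+ y ‖²)))
      where
      z·p+y-primitive : Primitive p (z ·[ p ]+ y)
      z·p+y-primitive = Equivalence.from (primitive-·[]+⇔ ∣-refl z y) (digits≢0⇒primitive y<p y≢0)
    F-0ᵛ : ∀ z → F (z ·[ p ]+ 0ᵛ k) ≡ 𝟙 (p ^ (1 + t) ∣? p * (p * ‖ z ‖²))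
    F-0ᵛ z = trans
      (cong₂ _*_ (cong (𝟙 ∘ (p ^ (1 + t) ∣?_)) (‖z·[m]+0‖² p z)) (𝟙-yes (¬? (primitive? p _)) z·p+0-not-primitive))
      (*-identityʳ _)
      where
      z·p+0-not-primitive : ¬ Primitive p (z ·[ p ]+ 0ᵛ k)
      z·p+0-not-primitive = ¬primitive-0ᵛ k ∘ Equivalence.to (primitive-·[]+⇔ ∣-refl z (0ᵛ k))

  Q-1 : Q 1 ≡ 1
  Q-1 = begin
    Q 1                                                ≡⟨ Q-digits 0 ⟩
    ∑[ z ∈ [ 1 ]^ k ] 𝟙 (p ^ 1 ∣? p * (p * ‖ z ‖²))  ≡⟨ ∑ᵛ-cong 1 k (λ z → 𝟙-yes (_ ∣? _) (*-monoʳ-∣ p (1∣ _))) ⟩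
    ∑[ _ ∈ [ 1 ]^ k ] 1                                ≡⟨ ∑ᵛ-[1]-const k 1 ⟩
    1                                                  ∎

  Q-2+ : ∀ t → Q (2 + t) ≡ p ^ k * R t
  Q-2+ t = begin
    Q (2 + t)
      ≡⟨ Q-digits (1 + t) ⟩
    ∑[ z ∈ [ p * p ^ t ]^ k ] 𝟙 (p * (p * p ^ t) ∣? p * (p * ‖ z ‖²))
      ≡⟨ ∑ᵛ-cong (p * p ^ t) k (λ z → 𝟙-cong (_ ∣? _) (_ ∣? _) cancel-p²) ⟩
    ∑[ z ∈ [ p * p ^ t ]^ k ] 𝟙 (p ^ t ∣? ‖ z ‖²)
      ≡⟨ ∑-periodic p (p ^ t) k ⟩
    p ^ k * R t ∎
    where
    cancel-p² : ∀ {s} → p * (p * p ^ t) ∣ p * (p * s) ⇔ p ^ t ∣ s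
    cancel-p² = mk⇔ (*-cancelˡ-∣ p ∘ *-cancelˡ-∣ p) (*-monoʳ-∣ p ∘ *-monoʳ-∣ p)

  ∑-lifts : ∀ t (y : Vec ℕ k) → Primitive p y →
            ∑[ z ∈ [ p ]^ k ] 𝟙 (p ^ (2 + t) ∣? ‖ z ·[ p ^ (1 + t) ]+ y ‖²) ≡ p ^ (k ∸ 1) * 𝟙 (p ^ (1 + t) ∣? ‖ y ‖²)
  ∑-lifts t y prim with p ^ (1 + t) ∣? ‖ y ‖²
  ... | no m∤‖y‖² = trans (∑ᵛ-zero p k λ {z} _ → 𝟙-no (p * m ∣? ‖ z ·[ m ]+ y ‖²) λ pm∣ →
                      m∤‖y‖² (Equivalence.to (∣‖z·[m]+y‖²⇔∣‖y‖² ∣-refl z y) (m*n∣⇒n∣ p m pm∣)))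
                    (sym (*-zeroʳ (p ^ (k ∸ 1))))
    where
    m = p ^ (1 + t)
  ... | yes (divides c ‖y‖²≡cm) = begin
    ∑[ z ∈ [ p ]^ k ] 𝟙 (p * m ∣? ‖ z ·[ m ]+ y ‖²)  ≡⟨ ∑ᵛ-cong p k (λ z → 𝟙-cong (_ ∣? _) (p ∣? _) (lifts⇔ z)) ⟩
    ∑[ z ∈ [ p ]^ k ] 𝟙 (p ∣? c + dot 2y z)          ≡⟨ ∑-hyperplane p-prime 2y c primitive-2y ⟩
    p ^ (k ∸ 1)                                      ≡⟨ *-identityʳ _ ⟨
    p ^ (k ∸ 1) * 1                                  ∎
    where
    m = p ^ (1 + t)
    instance
      m≢0 : NonZero m
      m≢0 = m^n≢0 p (1 + t)
    2y = V.map (2 *_) y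
    primitive-2y : Primitive p 2y
    primitive-2y = primitive-*ˡ p-prime (odd-prime∤2 p-prime p-odd) prim
    expansion : ∀ z → ‖ z ·[ m ]+ y ‖² ≡ m * ((c + dot 2y z) + m * ‖ z ‖²)
    expansion z = begin
      ‖ z ·[ m ]+ y ‖²                         ≡⟨ ‖z·[m]+y‖² m z y ⟩
      ‖ y ‖² + m * (2 * dot y z + m * ‖ z ‖²)  ≡⟨ cong₂ (λ a b → a + m * (b + m * ‖ z ‖²)) ‖y‖²≡cm (sym (dot-*ˡ 2 y z)) ⟩
      c * m + m * (dot 2y z + m * ‖ z ‖²)      ≡⟨ factor c m (dot 2y z) ‖ z ‖² ⟩
      m * ((c + dot 2y z) + m * ‖ z ‖²)        ∎
      where
      factor : ∀ c m d s → c * m + m * (d + m * s) ≡ m * ((c + d) + m * s)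
      factor = solve-∀
    lifts⇔ : ∀ z → p * m ∣ ‖ z ·[ m ]+ y ‖² ⇔ p ∣ c + dot 2y z
    lifts⇔ z = mk⇔
      (Equivalence.to p∣⇔ ∘ *-cancelˡ-∣ m ∘ subst₂ _∣_ (*-comm p m) (expansion z))
      (subst₂ _∣_ (*-comm m p) (sym (expansion z)) ∘ *-monoʳ-∣ m ∘ Equivalence.from p∣⇔)
      where
      p∣⇔ : p ∣ (c + dot 2y z) + m * ‖ z ‖² ⇔ p ∣ c + dot 2y z
      p∣⇔ = ∣m+n⇔∣m _ (∣m⇒∣m*n ‖ z ‖² (m∣m*n (p ^ t)))

  P-step : ∀ t → P (2 + t) ≡ p ^ (k ∸ 1) * P (1 + t)
  P-step t = begin
    ∑ᵛ (p * m) k H                                           ≡⟨ ∑ᵛ-* p m k H ⟩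
    ∑[ z ∈ [ p ]^ k ] ∑[ y ∈ [ m ]^ k ] H (z ·[ m ]+ y)      ≡⟨ ∑ᵛ-comm p m k _ ⟩
    ∑[ y ∈ [ m ]^ k ] ∑[ z ∈ [ p ]^ k ] H (z ·[ m ]+ y)      ≡⟨ ∑ᵛ-cong m k lifts ⟩
    ∑[ y ∈ [ m ]^ k ] (p ^ (k ∸ 1) * G y)                    ≡⟨ *-distribˡ-∑ᵛ m k (p ^ (k ∸ 1)) G ⟩
    p ^ (k ∸ 1) * P (1 + t)                                  ∎
    where
    m = p ^ (1 + t)
    H G : Vec ℕ k → ℕ
    H v = 𝟙 (p * m ∣? ‖ v ‖²) * 𝟙 (primitive? p v)
    G y = 𝟙 (m ∣? ‖ y ‖²) * 𝟙 (primitive? p y)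
    lifts : ∀ y → ∑[ z ∈ [ p ]^ k ] H (z ·[ m ]+ y) ≡ p ^ (k ∸ 1) * G y
    lifts y = begin
      ∑[ z ∈ [ p ]^ k ] H (z ·[ m ]+ y)                 ≡⟨ ∑ᵛ-cong p k H-lift ⟩
      ∑[ z ∈ [ p ]^ k ] (𝟙 (primitive? p y) * D z)      ≡⟨ *-distribˡ-∑ᵛ p k (𝟙 (primitive? p y)) D ⟩
      𝟙 (primitive? p y) * ∑[ z ∈ [ p ]^ k ] D z        ≡⟨ 𝟙-*-cong (primitive? p y) (∑-lifts t y) ⟩
      𝟙 (primitive? p y) * (p ^ (k ∸ 1) * 𝟙 (m ∣? ‖ y ‖²)) ≡⟨ rearrange (𝟙 (primitive? p y)) (p ^ (k ∸ 1)) _ ⟩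
      p ^ (k ∸ 1) * G y                                   ∎
      where
      D : Vec ℕ k → ℕ
      D z = 𝟙 (p * m ∣? ‖ z ·[ m ]+ y ‖²)
      H-lift : ∀ z → H (z ·[ m ]+ y) ≡ 𝟙 (primitive? p y) * D z
      H-lift z = trans (cong (D z *_) (𝟙-cong (primitive? p _) (primitive? p y) (primitive-·[]+⇔ (m∣m*n (p ^ t)) z y)))
                       (*-comm (D z) (𝟙 (primitive? p y)))
      rearrange : ∀ a b c → a * (b * c) ≡ b * (c * a)
      rearrange = solve-∀

  P-1+ : ∀ t → P (1 + t) ≡ p ^ (t * (k ∸ 1)) * P 1
  P-1+ zero    = sym (+-identityʳ (P 1))
  P-1+ (suc t) = begin
    P (2 + t)                                   ≡⟨ P-step t ⟩
    p ^ (k ∸ 1) * P (1 + t)                     ≡⟨ cong (p ^ (k ∸ 1) *_) (P-1+ t) ⟩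
    p ^ (k ∸ 1) * (p ^ (t * (k ∸ 1)) * P 1)     ≡⟨ *-assoc (p ^ (k ∸ 1)) _ (P 1) ⟨
    p ^ (k ∸ 1) * p ^ (t * (k ∸ 1)) * P 1       ≡⟨ cong (_* P 1) (^-distribˡ-+-* p (k ∸ 1) (t * (k ∸ 1))) ⟨
    p ^ (suc t * (k ∸ 1)) * P 1                 ∎

  R-0 : R 0 ≡ 1
  R-0 = trans (∑ᵛ-cong 1 k (λ v → 𝟙-yes (1 ∣? ‖ v ‖²) (1∣ _))) (∑ᵛ-[1]-const k 1)

  R-1 : R 1 ≡ P 1 + 1
  R-1 = trans (R≡P+Q 1) (cong (P 1 +_) Q-1)

  R-2+ : ∀ t → R (2 + t) ≡ p ^ ((1 + t) * (k ∸ 1)) * P 1 + p ^ k * R t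
  R-2+ t = trans (R≡P+Q (2 + t)) (cong₂ _+_ (P-1+ (1 + t)) (Q-2+ t))

[2+m]/2≡1+m/2 : ∀ m → (2 + m) / 2 ≡ 1 + m / 2
[2+m]/2≡1+m/2 m = m/n≡1+[m∸n]/n {2 + m} (s≤s (s≤s z≤n))

module ClosedForm (p k A : ℕ) where

  term : ℕ → ℕ → ℕ
  term s i = p ^ (k * i) * p ^ ((s ∸ 2 * i ∸ 1) * (k ∸ 1)) * A

  term-0 : ∀ s → term s 0 ≡ p ^ ((s ∸ 1) * (k ∸ 1)) * A
  term-0 s = trans (cong (λ e → p ^ e * p ^ ((s ∸ 1) * (k ∸ 1)) * A) (*-zeroʳ k))
                   (cong (_* A) (*-identityˡ (p ^ ((s ∸ 1) * (k ∸ 1)))))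

  term-suc : ∀ s i → term (2 + s) (suc i) ≡ p ^ k * term s i
  term-suc s i = begin
    p ^ (k * suc i) * p ^ ((2 + s ∸ 2 * suc i ∸ 1) * (k ∸ 1)) * A
      ≡⟨ cong₂ (λ e f → p ^ e * p ^ ((2 + s ∸ f ∸ 1) * (k ∸ 1)) * A) (*-suc k i) (*-suc 2 i) ⟩
    p ^ (k + k * i) * p ^ ((s ∸ 2 * i ∸ 1) * (k ∸ 1)) * A
      ≡⟨ cong (λ x → x * p ^ ((s ∸ 2 * i ∸ 1) * (k ∸ 1)) * A) (^-distribˡ-+-* p k (k * i)) ⟩
    p ^ k * p ^ (k * i) * p ^ ((s ∸ 2 * i ∸ 1) * (k ∸ 1)) * A
      ≡⟨ reassoc (p ^ k) (p ^ (k * i)) _ A ⟩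
    p ^ k * term s i ∎
    where
    reassoc : ∀ a b c d → a * b * c * d ≡ a * (b * c * d)
    reassoc = solve-∀

  closed-form : (r : ℕ → ℕ) → r 0 ≡ 1 → r 1 ≡ A + 1 →
                (∀ t → r (2 + t) ≡ p ^ ((1 + t) * (k ∸ 1)) * A + p ^ k * r t) →
                ∀ s → r (suc s) ≡ ∑[ i < s / 2 + 1 ] term (suc s) i + p ^ (suc s / 2 * k)
  closed-form r r₀ r₁ r₂₊ zero = begin
    r 1                 ≡⟨ r₁ ⟩
    A + 1               ≡⟨ cong (_+ 1) (trans (+-identityʳ _) (trans (term-0 1) (*-identityˡ A))) ⟨
    (term 1 0 + 0) + 1  ∎
  closed-form r r₀ r₁ r₂₊ (suc zero) = begin
    r 2                                  ≡⟨ r₂₊ 0 ⟩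
    p ^ (1 * (k ∸ 1)) * A + p ^ k * r 0  ≡⟨ cong₂ _+_ (sym (trans (+-identityʳ _) (term-0 2))) pᵏ*r₀ ⟩
    (term 2 0 + 0) + p ^ (1 * k)         ∎
    where
    pᵏ*r₀ : p ^ k * r 0 ≡ p ^ (1 * k)
    pᵏ*r₀ = trans (cong (p ^ k *_) r₀) (trans (*-identityʳ _) (cong (p ^_) (sym (*-identityˡ k))))
  closed-form r r₀ r₁ r₂₊ (suc (suc s)) = begin
    r (3 + s)
      ≡⟨ r₂₊ (1 + s) ⟩
    p ^ ((2 + s) * (k ∸ 1)) * A + p ^ k * r (1 + s)
      ≡⟨ cong₂ _+_ (sym (term-0 (3 + s))) (cong (p ^ k *_) (closed-form r r₀ r₁ r₂₊ s)) ⟩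
    term (3 + s) 0 + p ^ k * (∑[ i < n ] term (1 + s) i + p ^ ((1 + s) / 2 * k))
      ≡⟨ distrib (term (3 + s) 0) (p ^ k) _ _ ⟩
    (term (3 + s) 0 + p ^ k * ∑[ i < n ] term (1 + s) i) + p ^ k * p ^ ((1 + s) / 2 * k)
      ≡⟨ cong₂ _+_ (cong (term (3 + s) 0 +_) shift) (sym (^-distribˡ-+-* p k _)) ⟩
    ∑[ i < suc n ] term (3 + s) i + p ^ (suc ((1 + s) / 2) * k)
      ≡⟨ cong₂ (λ a b → ∑[ i < a + 1 ] term (3 + s) i + p ^ (b * k)) ([2+m]/2≡1+m/2 s) ([2+m]/2≡1+m/2 (1 + s)) ⟨
    ∑[ i < (2 + s) / 2 + 1 ] term (3 + s) i + p ^ ((3 + s) / 2 * k) ∎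
    where
    n = s / 2 + 1
    distrib : ∀ a b c d → a + b * (c + d) ≡ (a + b * c) + b * d
    distrib = solve-∀
    shift : p ^ k * ∑[ i < n ] term (1 + s) i ≡ ∑[ i < n ] term (3 + s) (suc i)
    shift = trans (sym (*-distribˡ-∑ n (p ^ k) _)) (∑-cong n λ i → sym (term-suc (1 + s) i))

sum-map-applyUpTo : ∀ n (f g : ℕ → ℕ) → sum (map f (applyUpTo g n)) ≡ ∑[ i < n ] f (g i)
sum-map-applyUpTo zero    f g = refl
sum-map-applyUpTo (suc n) f g = cong (f (g 0) +_) (sum-map-applyUpTo n f (g ∘ suc))

2*i≤s : ∀ s {i} → i < s / 2 + 1 → 2 * i ≤ s
2*i≤s s {i} i<s/2+1 = ≤-trans (*-monoʳ-≤ 2 i≤s/2) (subst (_≤ s) (*-comm (s / 2) 2) (m/n*n≤m s 2))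
  where
  i≤s/2 : i ≤ s / 2
  i≤s/2 = m<1+n⇒m≤n (subst (i <_) (+-comm (s / 2) 1) i<s/2+1)

p^1∣p^e : ∀ p {e} → e ≥ 1 → p ^ 1 ∣ p ^ e
p^1∣p^e p {suc e} _ = *-monoʳ-∣ p (1∣ (p ^ e))

-- Opened only here: with ℤ's +_ in scope, sections such as (a +_) are ambiguous.
open import Data.Integer using (+_)

theorem2 : (p s k : ℕ) → Prime p → ¬ (2 ∣ p) → s ≥ 1 → k ≥ 1 →
    ρ k (+ 0) (p ^ s)
      ≡ sum (map (λ i → (p ^ (k * i)) * (p ^ ((s ∸ 2 * i ∸ 1) * (k ∸ 1))) * ρ⁽¹⁾ k (+ (p ^ (s ∸ 2 * i))) p 1)
                 (upTo ((s ∸ 1) / 2 + 1)))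
        + p ^ ((s / 2) * k)
theorem2 p (suc s) k p-prime p-odd _ _ = begin
  ρ k (+ 0) (p ^ suc s)                  ≡⟨ ρ≡∑ k (p ^ suc s) ⟩
  R (suc s)                              ≡⟨ closed-form R R-0 R-1 R-2+ s ⟩
  ∑[ i < n ] term (suc s) i + p ^ e      ≡⟨ cong (_+ p ^ e) (∑-cong-< n summand≡term) ⟨
  ∑[ i < n ] summand i + p ^ e           ≡⟨ cong (_+ p ^ e) (sum-map-applyUpTo n summand id) ⟨
  sum (map summand (upTo n)) + p ^ e     ∎
  where
  open Counts p-prime p-odd k
  open ClosedForm p k (P 1)
  n = s / 2 + 1
  e = suc s / 2 * k
  summand : ℕ → ℕ
  summand i = p ^ (k * i) * p ^ ((suc s ∸ 2 * i ∸ 1) * (k ∸ 1)) * ρ⁽¹⁾ k (+ (p ^ (suc s ∸ 2 * i))) p 1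
  summand≡term : ∀ {i} → i < n → summand i ≡ term (suc s) i
  summand≡term {i} i< = cong (p ^ (k * i) * p ^ ((suc s ∸ 2 * i ∸ 1) * (k ∸ 1)) *_)
                             (ρ⁽¹⁾≡∑ k p (p ^ (suc s ∸ 2 * i)) (p^1∣p^e p (m<n⇒0<n∸m (s≤s (2*i≤s s i<)))))
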